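{- Let $(L,\leq)$ be a finite lattice. There is a bijection between the set of weak factorization systems on $L$ and the set of elevating subsets of $\operatorname{Rel}^*(L)$.
   Context: A finite lattice $(L,\leq)$ is viewed as a category with a unique morphism $a\to b$ whenever $a\leq b$. $\operatorname{Rel}^*(L)$ is the set of pairs $(a,b)$ with $a<b$. A relation $(a,b)$ lifts on the left a relation $(c,d)$ if whenever $a\leq c$ and $b\leq d$ we have $b\leq c$. A weak factorization system on $L$ is a pair $(\mathcal{L},\mathcal{R})$ of sets of relations such that every relation $a\leq b$ factors as $a\leq x\leq b$ with $(a,x)\in\mathcal{L}$, $(x,b)\in\mathcal{R}$, $\mathcal{L}$ is exactly the set of relations lifting on the left every relation of $\mathcal{R}$, and $\mathcal{R}$ is exactly the set of relations lifted on the left by every relation of $\mathcal{L}$. A subset $S\subseteq\operatorname{Rel}^*(L)$ is elevating if for all distinct $(a,b),(c,d)\in S$, $(a,b)$ lifts on the left $(c,d)$ (and hence also $(c,d)$ lifts on the left $(a,b)$). The bijection sends an elevating set $S$ to the weak factorization system whose right class is the smallest transfer system containing $S$. -}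

module Defs where

open import Level using (0ℓ)
open import Data.Nat using (ℕ)
open import Data.Fin using (Fin)
open import Data.Bool using (Bool; true)
open import Data.Vec using (Vec; lookup)
open import Data.Product using (Σ; _×_; _,_; proj₁; proj₂; ∃-syntax)
open import Relation.Nullary using (¬_)
open import Relation.Binary using (Rel; Setoid)
open import Relation.Binary.Lattice.Structures using (IsLattice)
open import Relation.Binary.PropositionalEquality using (_≡_; _≢_)
import Relation.Binary.PropositionalEquality as ≡
import Relation.Binary.Construct.On as On

-- A finite lattice, presented (up to isomorphism) as a lattice order on Fin n.
record FinLattice (n : ℕ) : Set₁ where
  field
    _≤_       : Rel (Fin n) 0ℓ
    _∨_       : Fin n → Fin n → Fin n
    _∧_       : Fin n → Fin n → Fin n
    isLattice : IsLattice _≡_ _≤_ _∨_ _∧_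

-- A set of pairs (a , b) of elements of Fin n, as a Boolean n×n matrix.
RelSet : ℕ → Set
RelSet n = Vec (Vec Bool n) n

_∋_,_ : ∀ {n} → RelSet n → Fin n → Fin n → Set
S ∋ a , b = lookup (lookup S a) b ≡ true

module _ {n : ℕ} (𝕃 : FinLattice n) where
  open FinLattice 𝕃

  LiftsLeft : Fin n → Fin n → Fin n → Fin n → Set
  LiftsLeft a b c d = a ≤ c → b ≤ d → b ≤ c

  IsRelSet : RelSet n → Set
  IsRelSet S = ∀ a b → S ∋ a , b → a ≤ b

  IsRel*Set : RelSet n → Set
  IsRel*Set S = ∀ a b → S ∋ a , b → (a ≤ b × a ≢ b)

  record IsWFS (𝓛 𝓡 : RelSet n) : Set where
    field
      𝓛-rel   : IsRelSet 𝓛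
      𝓡-rel   : IsRelSet 𝓡
      factor  : ∀ a b → a ≤ b →
                ∃[ x ] (a ≤ x × x ≤ b × 𝓛 ∋ a , x × 𝓡 ∋ x , b)
      𝓛-exact : ∀ a b → a ≤ b →
                (𝓛 ∋ a , b → ∀ c d → 𝓡 ∋ c , d → LiftsLeft a b c d)
                × ((∀ c d → 𝓡 ∋ c , d → LiftsLeft a b c d) → 𝓛 ∋ a , b)
      𝓡-exact : ∀ c d → c ≤ d →
                (𝓡 ∋ c , d → ∀ a b → 𝓛 ∋ a , b → LiftsLeft a b c d)
                × ((∀ a b → 𝓛 ∋ a , b → LiftsLeft a b c d) → 𝓡 ∋ c , d)

  record IsElevating (S : RelSet n) : Set where
    field
      rel*      : IsRel*Set S
      elevating : ∀ a b c d → S ∋ a , b → S ∋ c , d →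
                  ¬ (a ≡ c × b ≡ d) → LiftsLeft a b c d

  -- The set of weak factorization systems on L (two WFSs are equal iff
  -- their classes are equal; proofs are irrelevant).
  WFS : Set
  WFS = Σ (RelSet n × RelSet n) (λ p → IsWFS (proj₁ p) (proj₂ p))

  WFS-setoid : Setoid 0ℓ 0ℓ
  WFS-setoid = On.setoid {B = WFS} (≡.setoid (RelSet n × RelSet n)) proj₁

  -- The set of elevating subsets of Rel*(L) (equality of underlying sets).
  Elevating : Set
  Elevating = Σ (RelSet n) IsElevating

  Elevating-setoid : Setoid 0ℓ 0ℓ
  Elevating-setoid = On.setoid {B = Elevating} (≡.setoid (RelSet n)) proj₁

{-# OPTIONS --safe #-}
-- A weak factorization system (L , R) is determined by its right class: L = llp R and
-- R = rlp L. Any class of the form rlp L is a transfer system (reflexive, transitive,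
-- stable under pullback), and on a finite lattice the lifting conditions already force
-- factorizations: a ≤ b factors through the least x ∈ [a , b] with (x , b) ∈ R.
-- The elevating set of R is its set of generators: the indecomposable relations of R
-- that are not pullbacks of indecomposables with a larger target. Every relation of a
-- transfer system composes from indecomposables, each a pullback of a generator, so R is
-- the transfer system generated by its generators. Conversely, for elevating S the
-- lifting property singles out S as exactly the generators of rlp (llp S).
module Submission where

open import Defs
open import Data.Nat using (ℕ)
open import Function.Bundles using (Inverse; mk⇔)

open import Level using (0ℓ)
open import Function.Base using (_∘_; flip)
open import Data.Bool using (true)
open import Data.Bool.Properties using (⇔→≡)
import Data.Bool as Bool
open import Data.Empty using (⊥-elim)
open import Data.Fin using (Fin; _≟_)
open import Data.Fin.Properties using (all?; any?)
open import Data.Fin.Induction using (po-wellFounded; po-noetherian)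
open import Data.Product using (_×_; _,_; proj₁; proj₂; ∃-syntax)
open import Data.Sum using (_⊎_; inj₁; inj₂)
open import Data.Vec using (Vec; lookup; tabulate)
open import Data.Vec.Properties using (lookup∘tabulate; tabulate∘lookup; tabulate-cong)
open import Induction.WellFounded using (Acc; acc)
open import Relation.Binary using (Rel; Decidable)
open import Relation.Binary.Lattice using (Lattice)
open import Relation.Binary.PropositionalEquality
  using (_≡_; refl; sym; trans; cong; cong₂; subst; module ≡-Reasoning)
open import Relation.Nullary using (¬_; Dec; yes; no; does; proof)
open import Relation.Nullary.Decidable using (dec-true; ¬?; _×-dec_; _→-dec_)
open import Relation.Nullary.Reflects using (Reflects; invert)
open import Relation.Unary using (Pred)
import Relation.Binary.Lattice.Properties.JoinSemilattice as JoinSemilatticeProperties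
import Relation.Binary.Properties.Poset as PosetProperties

module _ {n : ℕ} where

  _⊆_ : RelSet n → RelSet n → Set
  S ⊆ T = ∀ {a b} → S ∋ a , b → T ∋ a , b

  lookup-ext : ∀ {A : Set} {xs ys : Vec A n} → (∀ i → lookup xs i ≡ lookup ys i) → xs ≡ ys
  lookup-ext {xs = xs} {ys} eq = begin
    xs                  ≡⟨ tabulate∘lookup xs ⟨
    tabulate (lookup xs) ≡⟨ tabulate-cong eq ⟩
    tabulate (lookup ys) ≡⟨ tabulate∘lookup ys ⟩
    ys                  ∎
    where open ≡-Reasoning

  ⊆-antisym : {S T : RelSet n} → S ⊆ T → T ⊆ S → S ≡ T
  ⊆-antisym S⊆T T⊆S = lookup-ext λ a → lookup-ext λ b → ⇔→≡ (mk⇔ S⊆T T⊆S)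

  _∋?_,_ : (S : RelSet n) → Decidable (S ∋_,_)
  S ∋? a , b = lookup (lookup S a) b Bool.≟ true

  fromDecidable : {P : Rel (Fin n) 0ℓ} → Decidable P → RelSet n
  fromDecidable P? = tabulate λ a → tabulate λ b → does (P? a b)

  module _ {P : Rel (Fin n) 0ℓ} (P? : Decidable P) {a b : Fin n} where

    lookup-fromDecidable : lookup (lookup (fromDecidable P?) a) b ≡ does (P? a b)
    lookup-fromDecidable =
      trans (cong (λ row → lookup row b) (lookup∘tabulate _ a)) (lookup∘tabulate _ b)

    ∈-fromDecidable⁺ : P a b → fromDecidable P? ∋ a , b
    ∈-fromDecidable⁺ p = trans lookup-fromDecidable (dec-true (P? a b) p)

    ∈-fromDecidable⁻ : fromDecidable P? ∋ a , b → P a b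
    ∈-fromDecidable⁻ m =
      invert (subst (Reflects (P a b)) (trans (sym lookup-fromDecidable) m) (proof (P? a b)))

module _ {n : ℕ} (𝕃 : FinLattice n) where

  open FinLattice 𝕃

  private
    lattice : Lattice 0ℓ 0ℓ 0ℓ
    lattice = record { isLattice = isLattice }

  open Lattice lattice
    using (isPartialOrder; antisym; x∧y≤x; x∧y≤y; ∧-greatest; poset; joinSemilattice)
    renaming (refl to ≤-refl; trans to ≤-trans)
  open PosetProperties poset using (_<_; <⇒≱)
  open JoinSemilatticeProperties joinSemilattice using (≈-dec⇒≤-dec)

  _≤?_ : Decidable _≤_
  _≤?_ = ≈-dec⇒≤-dec _≟_

  x≤y⇒x∧y≡x : ∀ {x y} → x ≤ y → x ∧ y ≡ x
  x≤y⇒x∧y≡x x≤y = antisym (x∧y≤x _ _) (∧-greatest ≤-refl x≤y)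

  _<?_ : Decidable _<_
  x <? y = x ≤? y ×-dec ¬? (x ≟ y)

  <-acc : ∀ x → Acc _<_ x
  <-acc = po-wellFounded isPartialOrder

  >-acc : ∀ x → Acc (flip _<_) x
  >-acc = po-noetherian isPartialOrder

  private variable
    a b c d x : Fin n
    L R S T : RelSet n

  ≡⇒⊆ : S ≡ T → S ⊆ T
  ≡⇒⊆ refl s = s

  liftsLeft? : ∀ a b c d → Dec (LiftsLeft 𝕃 a b c d)
  liftsLeft? a b c d = a ≤? c →-dec b ≤? d →-dec b ≤? c

  HasLLP : RelSet n → Rel (Fin n) 0ℓ
  HasLLP R a b = a ≤ b × ∀ c d → R ∋ c , d → LiftsLeft 𝕃 a b c d

  HasRLP : RelSet n → Rel (Fin n) 0ℓ
  HasRLP L c d = c ≤ d × ∀ a b → L ∋ a , b → LiftsLeft 𝕃 a b c d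

  hasLLP? : (R : RelSet n) → Decidable (HasLLP R)
  hasLLP? R a b = a ≤? b ×-dec all? λ c → all? λ d → R ∋? c , d →-dec liftsLeft? a b c d

  hasRLP? : (L : RelSet n) → Decidable (HasRLP L)
  hasRLP? L c d = c ≤? d ×-dec all? λ a → all? λ b → L ∋? a , b →-dec liftsLeft? a b c d

  -- Opaque, so that the set can be inferred from a membership goal.
  opaque
    llp : RelSet n → RelSet n
    llp R = fromDecidable (hasLLP? R)

    rlp : RelSet n → RelSet n
    rlp L = fromDecidable (hasRLP? L)

    ∈-llp⁺ : HasLLP R a b → llp R ∋ a , b
    ∈-llp⁺ {R} = ∈-fromDecidable⁺ (hasLLP? R)

    ∈-llp⁻ : llp R ∋ a , b → HasLLP R a b
    ∈-llp⁻ {R} = ∈-fromDecidable⁻ (hasLLP? R)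

    ∈-rlp⁺ : HasRLP L c d → rlp L ∋ c , d
    ∈-rlp⁺ {L} = ∈-fromDecidable⁺ (hasRLP? L)

    ∈-rlp⁻ : rlp L ∋ c , d → HasRLP L c d
    ∈-rlp⁻ {L} = ∈-fromDecidable⁻ (hasRLP? L)

  llp-isRelSet : IsRelSet 𝕃 (llp R)
  llp-isRelSet _ _ = proj₁ ∘ ∈-llp⁻

  rlp-isRelSet : IsRelSet 𝕃 (rlp L)
  rlp-isRelSet _ _ = proj₁ ∘ ∈-rlp⁻

  llp-antitone : R ⊆ T → llp T ⊆ llp R
  llp-antitone R⊆T m with ∈-llp⁻ m
  ... | a≤b , lifts = ∈-llp⁺ (a≤b , λ c d r → lifts c d (R⊆T r))

  rlp-antitone : L ⊆ T → rlp T ⊆ rlp L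
  rlp-antitone L⊆T m with ∈-rlp⁻ m
  ... | c≤d , lifts = ∈-rlp⁺ (c≤d , λ a b l → lifts a b (L⊆T l))

  ⊆-rlp-llp : IsRelSet 𝕃 S → S ⊆ rlp (llp S)
  ⊆-rlp-llp S-rel s = ∈-rlp⁺ (S-rel _ _ s , λ a b l → proj₂ (∈-llp⁻ l) _ _ s)

  ⊆-llp-rlp : IsRelSet 𝕃 S → S ⊆ llp (rlp S)
  ⊆-llp-rlp S-rel s = ∈-llp⁺ (S-rel _ _ s , λ c d r → proj₂ (∈-rlp⁻ r) _ _ s)

  llp-rlp-llp : IsRelSet 𝕃 S → llp (rlp (llp S)) ≡ llp S
  llp-rlp-llp S-rel = ⊆-antisym (llp-antitone (⊆-rlp-llp S-rel)) (⊆-llp-rlp llp-isRelSet)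

  ∩-rlp⇒≥ : L ∋ a , b → rlp L ∋ a , b → b ≤ a
  ∩-rlp⇒≥ l r = proj₂ (∈-rlp⁻ r) _ _ l ≤-refl ≤-refl

  record IsTransferSystem (R : RelSet n) : Set where
    field
      isRelSet   : IsRelSet 𝕃 R
      reflexive  : ∀ a → R ∋ a , a
      transitive : ∀ {a b c} → R ∋ a , b → R ∋ b , c → R ∋ a , c
      pullback   : ∀ {a b c} → R ∋ a , b → c ≤ b → R ∋ a ∧ c , c

    restrict : R ∋ a , c → a ≤ b → b ≤ c → R ∋ a , b
    restrict {a = a} {b = b} r a≤b b≤c =
      subst (λ x → R ∋ x , b) (x≤y⇒x∧y≡x a≤b) (pullback r b≤c)

    ∧-closed : R ∋ a , c → R ∋ b , c → R ∋ a ∧ b , c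
    ∧-closed ra rb = transitive (pullback ra (isRelSet _ _ rb)) rb

  rlp-isTransferSystem : IsTransferSystem (rlp L)
  rlp-isTransferSystem = record
    { isRelSet   = rlp-isRelSet
    ; reflexive  = λ _ → ∈-rlp⁺ (≤-refl , λ _ _ _ _ b≤a → b≤a)
    ; transitive = transitive
    ; pullback   = pullback
    }
    where
    transitive : rlp L ∋ a , b → rlp L ∋ b , c → rlp L ∋ a , c
    transitive r s with ∈-rlp⁻ r | ∈-rlp⁻ s
    ... | a≤b , lifts₁ | b≤c , lifts₂ = ∈-rlp⁺ (≤-trans a≤b b≤c , λ p q l p≤a q≤c →
      lifts₁ p q l p≤a (lifts₂ p q l (≤-trans p≤a a≤b) q≤c))

    pullback : rlp L ∋ a , b → c ≤ b → rlp L ∋ a ∧ c , c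
    pullback {a = a} {c = c} r c≤b with ∈-rlp⁻ r
    ... | _ , lifts = ∈-rlp⁺ (x∧y≤y a c , λ p q l p≤a∧c q≤c →
      ∧-greatest (lifts p q l (≤-trans p≤a∧c (x∧y≤x a c)) (≤-trans q≤c c≤b)) q≤c)

  ≡rlp⇒isTransferSystem : R ≡ rlp L → IsTransferSystem R
  ≡rlp⇒isTransferSystem refl = rlp-isTransferSystem

  module _ {P : Pred (Fin n) 0ℓ} (P? : ∀ x → Dec (P x)) where

    minimal : Acc _<_ x → P x → ∃[ m ] (P m × ∀ {y} → P y → ¬ y < m)
    minimal {x} (acc smaller) px with any? (λ y → P? y ×-dec y <? x)
    ... | yes (y , py , y<x) = minimal (smaller y<x) py
    ... | no ∄y<x            = x , px , λ py y<x → ∄y<x (_ , py , y<x)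

    ∧-closed⇒least : P x → (∀ {y z} → P y → P z → P (y ∧ z)) →
                     ∃[ m ] (P m × ∀ {y} → P y → m ≤ y)
    ∧-closed⇒least px ∧-closed with minimal (<-acc _) px
    ... | m , pm , m-minimal = m , pm , m≤
      where
      m≤ : ∀ {y} → P y → m ≤ y
      m≤ {y} py with m ∧ y ≟ m
      ... | yes m∧y≡m = subst (_≤ y) m∧y≡m (x∧y≤y m y)
      ... | no  m∧y≢m = ⊥-elim (m-minimal (∧-closed pm py) (x∧y≤x m y , m∧y≢m))

  module _ {R : RelSet n} (R-ts : IsTransferSystem R) {a b : Fin n} where
    open IsTransferSystem R-ts

    private
      Between : Pred (Fin n) 0ℓ
      Between y = a ≤ y × y ≤ b × R ∋ y , b

      between? : ∀ y → Dec (Between y)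
      between? y = a ≤? y ×-dec y ≤? b ×-dec R ∋? y , b

      ∧-closed-between : ∀ {y z} → Between y → Between z → Between (y ∧ z)
      ∧-closed-between (a≤y , y≤b , ry) (a≤z , _ , rz) =
        ∧-greatest a≤y a≤z , ≤-trans (x∧y≤x _ _) y≤b , ∧-closed ry rz

    factorization : a ≤ b → ∃[ x ] (a ≤ x × x ≤ b × llp R ∋ a , x × R ∋ x , b)
    factorization a≤b
      with ∧-closed⇒least between? (a≤b , ≤-refl , reflexive b) ∧-closed-between
    ... | x , (a≤x , x≤b , rx) , x-least = x , a≤x , x≤b , ∈-llp⁺ (a≤x , lifts) , rx
      where
      lifts : ∀ c d → R ∋ c , d → LiftsLeft 𝕃 a x c d
      lifts c d r a≤c x≤d = ≤-trans (x-least c∧x-between) (x∧y≤x c x)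
        where
        c∧x-between : Between (c ∧ x)
        c∧x-between =
          ∧-greatest a≤c a≤x , ≤-trans (x∧y≤y c x) x≤b , transitive (pullback r x≤d) rx

  module _ (W : IsWFS 𝕃 L R) where
    open IsWFS W

    wfs-𝓛≡llp : L ≡ llp R
    wfs-𝓛≡llp = ⊆-antisym
      (λ l → ∈-llp⁺ (𝓛-rel _ _ l , proj₁ (𝓛-exact _ _ (𝓛-rel _ _ l)) l))
      (λ m → let a≤b , lifts = ∈-llp⁻ m in proj₂ (𝓛-exact _ _ a≤b) lifts)

    wfs-𝓡≡rlp : R ≡ rlp L
    wfs-𝓡≡rlp = ⊆-antisym
      (λ r → ∈-rlp⁺ (𝓡-rel _ _ r , proj₁ (𝓡-exact _ _ (𝓡-rel _ _ r)) r))
      (λ m → let c≤d , lifts = ∈-rlp⁻ m in proj₂ (𝓡-exact _ _ c≤d) lifts)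

  closed⇒wfs : L ≡ llp R → R ≡ rlp L → IsWFS 𝕃 L R
  closed⇒wfs refl R≡rlp = record
    { 𝓛-rel   = llp-isRelSet
    ; 𝓡-rel   = λ _ _ → proj₁ ∘ ∈-rlp⁻ ∘ ≡⇒⊆ R≡rlp
    ; factor  = λ _ _ → factorization (≡rlp⇒isTransferSystem R≡rlp)
    ; 𝓛-exact = λ _ _ a≤b → proj₂ ∘ ∈-llp⁻ , λ lifts → ∈-llp⁺ (a≤b , lifts)
    ; 𝓡-exact = λ _ _ c≤d → proj₂ ∘ ∈-rlp⁻ ∘ ≡⇒⊆ R≡rlp ,
                            λ lifts → ≡⇒⊆ (sym R≡rlp) (∈-rlp⁺ (c≤d , lifts))
    }

  Decomposable : RelSet n → Rel (Fin n) 0ℓ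
  Decomposable R a b = ∃[ x ] (a < x × x < b × R ∋ x , b)

  Indecomposable : RelSet n → Rel (Fin n) 0ℓ
  Indecomposable R a b = a < b × R ∋ a , b × ¬ Decomposable R a b

  -- (a , b) is the pullback (c ∧ b , b) of the indecomposable (c , d) along b < d.
  StrictRestriction : RelSet n → Fin n → Fin n → Fin n → Fin n → Set
  StrictRestriction R a b c d = Indecomposable R c d × b < d × c ∧ b ≡ a

  Maximal : RelSet n → Rel (Fin n) 0ℓ
  Maximal R a b = ¬ (∃[ c ] ∃[ d ] StrictRestriction R a b c d)

  Generator : RelSet n → Rel (Fin n) 0ℓ
  Generator R a b = Indecomposable R a b × Maximal R a b

  decomposable? : (R : RelSet n) → Decidable (Decomposable R)
  decomposable? R a b = any? λ x → a <? x ×-dec x <? b ×-dec R ∋? x , b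

  indecomposable? : (R : RelSet n) → Decidable (Indecomposable R)
  indecomposable? R a b = a <? b ×-dec R ∋? a , b ×-dec ¬? (decomposable? R a b)

  strictRestriction? : (R : RelSet n) → ∀ a b c d → Dec (StrictRestriction R a b c d)
  strictRestriction? R a b c d = indecomposable? R c d ×-dec b <? d ×-dec c ∧ b ≟ a

  maximal? : (R : RelSet n) → Decidable (Maximal R)
  maximal? R a b = ¬? (any? λ c → any? λ d → strictRestriction? R a b c d)

  generator? : (R : RelSet n) → Decidable (Generator R)
  generator? R a b = indecomposable? R a b ×-dec maximal? R a b

  opaque
    generators : RelSet n → RelSet n
    generators R = fromDecidable (generator? R)

    ∈-generators⁺ : Generator R a b → generators R ∋ a , b
    ∈-generators⁺ {R} = ∈-fromDecidable⁺ (generator? R)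

    ∈-generators⁻ : generators R ∋ a , b → Generator R a b
    ∈-generators⁻ {R} = ∈-fromDecidable⁻ (generator? R)

  generators⊆ : generators R ⊆ R
  generators⊆ = proj₁ ∘ proj₂ ∘ proj₁ ∘ ∈-generators⁻

  generators-isRelSet : IsRelSet 𝕃 (generators R)
  generators-isRelSet _ _ = proj₁ ∘ proj₁ ∘ proj₁ ∘ ∈-generators⁻

  indecomposable-split : Indecomposable R a b → a ≤ x → x ≤ b → R ∋ x , b →
                         x ≡ a ⊎ x ≡ b
  indecomposable-split {a = a} {b = b} {x = x} (_ , _ , ¬decomposable) a≤x x≤b rx
    with x ≟ a | x ≟ b
  ... | yes x≡a | _       = inj₁ x≡a
  ... | no _    | yes x≡b = inj₂ x≡b
  ... | no x≢a  | no x≢b  =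
    ⊥-elim (¬decomposable (x , (a≤x , x≢a ∘ sym) , (x≤b , x≢b) , rx))

  generators-elevating : IsTransferSystem R → IsElevating 𝕃 (generators R)
  generators-elevating {R} R-ts = record
    { rel*      = λ _ _ → proj₁ ∘ proj₁ ∘ ∈-generators⁻
    ; elevating = elevating
    }
    where
    open IsTransferSystem R-ts

    elevating : ∀ a b c d → generators R ∋ a , b → generators R ∋ c , d →
                ¬ (a ≡ c × b ≡ d) → LiftsLeft 𝕃 a b c d
    elevating a b c d g h distinct a≤c b≤d with ∈-generators⁻ g | ∈-generators⁻ h
    ... | ab-indec@((a≤b , _) , _) , ab-maximal | cd-indec@((c≤d , _) , rcd , _) , _
      with indecomposable-split {R = R} ab-indec
             (∧-greatest a≤c a≤b) (x∧y≤y c b) (pullback rcd b≤d)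
    ... | inj₂ c∧b≡b = subst (_≤ c) c∧b≡b (x∧y≤x c b)
    ... | inj₁ c∧b≡a with b ≟ d
    ...   | no b≢d   = ⊥-elim (ab-maximal (c , d , cd-indec , (b≤d , b≢d) , c∧b≡a))
    ...   | yes refl = ⊥-elim (distinct (trans (sym c∧b≡a) (x≤y⇒x∧y≡x c≤d) , refl))

  module _ (R-ts : IsTransferSystem R) (T-ts : IsTransferSystem T)
           (generators⊆T : generators R ⊆ T) where
    private
      module R = IsTransferSystem R-ts
      module T = IsTransferSystem T-ts

    indecomposable⇒∈T : Acc (flip _<_) d → Indecomposable R c d → T ∋ c , d
    indecomposable⇒∈T {d = d} (acc larger) indec
      with any? (λ c′ → any? λ d′ → strictRestriction? R _ d c′ d′)
    ... | yes (c′ , d′ , indec′ , d<d′ , c′∧d≡c) =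
      subst (λ x → T ∋ x , d) c′∧d≡c
            (T.pullback (indecomposable⇒∈T (larger d<d′) indec′) (proj₁ d<d′))
    ... | no maximal = generators⊆T (∈-generators⁺ (indec , maximal))

    ∈⇒∈T : Acc _<_ d → Acc (flip _<_) c → R ∋ c , d → T ∋ c , d
    ∈⇒∈T {d = d} {c = c} (acc smaller) (acc larger) r with c ≟ d | decomposable? R c d
    ... | yes refl | _ = T.reflexive c
    ... | no _     | yes (x , c<x , x<d , rx) =
      T.transitive (∈⇒∈T (smaller x<d) (acc larger) (R.restrict r (proj₁ c<x) (proj₁ x<d)))
                   (∈⇒∈T (acc smaller) (larger c<x) rx)
    ... | no c≢d   | no ¬decomposable =
      indecomposable⇒∈T (>-acc d) ((R.isRelSet _ _ r , c≢d) , r , ¬decomposable)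

  generators-generate : IsTransferSystem R → IsTransferSystem T → generators R ⊆ T → R ⊆ T
  generators-generate R-ts T-ts generators⊆T =
    ∈⇒∈T R-ts T-ts generators⊆T (<-acc _) (>-acc _)

  rlp-llp-generators : R ≡ rlp (llp R) → rlp (llp (generators R)) ≡ R
  rlp-llp-generators {R} R≡rlp-llp = ⊆-antisym
    (≡⇒⊆ (sym R≡rlp-llp) ∘ rlp-antitone (llp-antitone generators⊆))
    (generators-generate (≡rlp⇒isTransferSystem R≡rlp-llp) rlp-isTransferSystem
                         (⊆-rlp-llp generators-isRelSet))

  generatedClasses : RelSet n → RelSet n × RelSet n
  generatedClasses S = llp S , rlp (llp S)

  wfs-generated : IsWFS 𝕃 L R → generatedClasses (generators R) ≡ (L , R)
  wfs-generated {L} {R} W = cong₂ _,_ llp-generators≡L rlp-llp-generators≡R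
    where
    open ≡-Reasoning
    rlp-llp-generators≡R : rlp (llp (generators R)) ≡ R
    rlp-llp-generators≡R = rlp-llp-generators (trans (wfs-𝓡≡rlp W) (cong rlp (wfs-𝓛≡llp W)))
    llp-generators≡L : llp (generators R) ≡ L
    llp-generators≡L = begin
      llp (generators R)               ≡⟨ llp-rlp-llp generators-isRelSet ⟨
      llp (rlp (llp (generators R)))   ≡⟨ cong llp rlp-llp-generators≡R ⟩
      llp R                            ≡⟨ wfs-𝓛≡llp W ⟨
      L                                ∎

  module _ {S : RelSet n} (E : IsElevating 𝕃 S) where
    open IsElevating E
    private
      module 𝓡 = IsTransferSystem (rlp-isTransferSystem {L = llp S})

    elevating-isRelSet : IsRelSet 𝕃 S
    elevating-isRelSet a b = proj₁ ∘ rel* a b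

    elevating⇒indecomposable : S ∋ a , b → Indecomposable (rlp (llp S)) a b
    elevating⇒indecomposable {a} {b} s =
      rel* a b s , ⊆-rlp-llp elevating-isRelSet s , ¬decomposable
      where
      ¬decomposable : ¬ Decomposable (rlp (llp S)) a b
      ¬decomposable (x , a<x , x<b , rx) = <⇒≱ x<b (∩-rlp⇒≥ (∈-llp⁺ (proj₁ x<b , lifts)) rx)
        where
        lifts : ∀ c d → S ∋ c , d → LiftsLeft 𝕃 x b c d
        lifts c d t x≤c b≤d with a ≟ c ×-dec b ≟ d
        ... | yes (refl , _) = ⊥-elim (<⇒≱ a<x x≤c)
        ... | no distinct    = elevating a b c d s t distinct (≤-trans (proj₁ a<x) x≤c) b≤d

    indecomposable⇒restriction : Indecomposable (rlp (llp S)) c d →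
                                 ∃[ e ] ∃[ f ] (S ∋ e , f × d ≤ f × e ∧ d ≡ c)
    indecomposable⇒restriction {c} {d} indec@(c<d , rcd , _)
      with any? (λ e → any? λ f → S ∋? e , f ×-dec d ≤? f ×-dec e ∧ d ≟ c)
    ... | yes restriction = restriction
    ... | no ¬restriction = ⊥-elim (<⇒≱ c<d (∩-rlp⇒≥ (∈-llp⁺ (proj₁ c<d , lifts)) rcd))
      where
      lifts : ∀ e f → S ∋ e , f → LiftsLeft 𝕃 c d e f
      lifts e f s c≤e d≤f
        with indecomposable-split {R = rlp (llp S)} indec
               (∧-greatest c≤e (proj₁ c<d)) (x∧y≤y e d)
               (𝓡.pullback (⊆-rlp-llp elevating-isRelSet s) d≤f)
      ... | inj₁ e∧d≡c = ⊥-elim (¬restriction (e , f , s , d≤f , e∧d≡c))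
      ... | inj₂ e∧d≡d = subst (_≤ e) e∧d≡d (x∧y≤x e d)

    S⊆generators : S ⊆ generators (rlp (llp S))
    S⊆generators {a} {b} s = ∈-generators⁺ (elevating⇒indecomposable s , maximal)
      where
      maximal : Maximal (rlp (llp S)) a b
      maximal (c , d , indec , b<d , c∧b≡a) with indecomposable⇒restriction indec
      ... | e , f , t , d≤f , e∧d≡c with a ≟ e ×-dec b ≟ f
      ... | yes (_ , refl) = <⇒≱ b<d d≤f
      ... | no distinct    = <⇒≱ (rel* a b s) b≤a
        where
        a≤e : a ≤ e
        a≤e = ≤-trans (subst (_≤ c) c∧b≡a (x∧y≤x c b)) (subst (_≤ e) e∧d≡c (x∧y≤x e d))
        b≤e : b ≤ e
        b≤e = elevating a b e f s t distinct a≤e (≤-trans (proj₁ b<d) d≤f)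
        b≤c : b ≤ c
        b≤c = subst (b ≤_) e∧d≡c (∧-greatest b≤e (proj₁ b<d))
        b≤a : b ≤ a
        b≤a = subst (b ≤_) c∧b≡a (∧-greatest b≤c ≤-refl)

    generators⊆S : generators (rlp (llp S)) ⊆ S
    generators⊆S {a} {b} g with ∈-generators⁻ g
    ... | indec , maximal with indecomposable⇒restriction indec
    ... | e , f , t , b≤f , e∧b≡a with b ≟ f
    ...   | yes refl = subst (λ x → S ∋ x , b) e≡a t
      where
      e≡a : e ≡ a
      e≡a = trans (sym (x≤y⇒x∧y≡x (elevating-isRelSet e b t))) e∧b≡a
    ...   | no b≢f   =
      ⊥-elim (maximal (e , f , elevating⇒indecomposable t , (b≤f , b≢f) , e∧b≡a))

    generators-rlp-llp : generators (rlp (llp S)) ≡ S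
    generators-rlp-llp = ⊆-antisym generators⊆S S⊆generators

  toElevating : WFS 𝕃 → Elevating 𝕃
  toElevating ((L , R) , W) =
    generators R , generators-elevating (≡rlp⇒isTransferSystem (wfs-𝓡≡rlp W))

  fromElevating : Elevating 𝕃 → WFS 𝕃
  fromElevating (S , E) =
    generatedClasses S , closed⇒wfs (sym (llp-rlp-llp (elevating-isRelSet E))) refl

mainTheorem5 : (n : ℕ) (𝕃 : FinLattice n) →
    Inverse (WFS-setoid 𝕃) (Elevating-setoid 𝕃)
mainTheorem5 n 𝕃 = record
  { to        = toElevating 𝕃
  ; from      = fromElevating 𝕃
  ; to-cong   = cong (generators 𝕃 ∘ proj₂)
  ; from-cong = cong (generatedClasses 𝕃)
  ; inverse   =
      (λ {(_ , E)} eq → trans (cong (generators 𝕃 ∘ proj₂) eq) (generators-rlp-llp 𝕃 E)) ,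
      (λ {(_ , W)} eq → trans (cong (generatedClasses 𝕃) eq) (wfs-generated 𝕃 W))
  }
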